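{- For every $i\geq 3$, the class of claw-o-heavy and $P_i$-c-heavy graphs is c-stable; that is, for every claw-o-heavy and $P_i$-c-heavy graph $G$, its c-closure $\mathrm{cl}^{\mathrm c}(G)$ is also claw-o-heavy and $P_i$-c-heavy.
   Context: All graphs are finite and simple. For a graph $G$ on $n=|V(G)|$ vertices, a vertex $v$ is heavy if $d_G(v)\geq n/2$; a pair $\{u,v\}$ is a heavy pair of $G$ if $uv\notin E(G)$ and $d_G(u)+d_G(v)\geq n$. $G$ is claw-o-heavy if every induced $K_{1,3}$ of $G$ contains a heavy pair of $G$. For a graph $S$, $G$ is $S$-c-heavy if for every induced subgraph $G'$ of $G$ isomorphic to $S$ and every maximal clique $C$ of $G'$, every component of $G'-C$ with at least two vertices contains a vertex heavy in $G$. $P_i$ is the path on $i$ vertices. For $x\in V(G)$, $G'_x$ is obtained from $G$ by adding all missing edges $uv$ with $u,v\in N_G(x)$. For claw-o-heavy $G$ and $x\in V(G)$, let $G^*$ be obtained from $G$ by adding all missing edges $uv$ with $u,v\in N_G(x)$ and $\{u,v\}$ a heavy pair of $G$; $x$ is c-eligible if $N_G(x)$ is not a clique and either $G^*[N_G(x)]$ is connected, or $G^*[N_G(x)]$ consists of two disjoint cliques $C_1,C_2$ and some $z$ with $\{x,z\}$ a heavy pair of $G$ has $zy_1,zy_2\in E(G)$ for some $y_1\in C_1,y_2\in C_2$. The c-closure $\mathrm{cl}^{\mathrm c}(G)$ of a claw-o-heavy graph $G$ is the graph obtained by a sequence $G=G_1,\dots,G_t=\mathrm{cl}^{\mathrm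 c}(G)$ where $G_{j+1}=(G_j)'_{x_j}$ for a c-eligible vertex $x_j$ of $G_j$, and $G_t$ has no c-eligible vertex; it is well defined (Čada). A class $\mathcal G$ of claw-o-heavy graphs is c-stable if $\mathrm{cl}^{\mathrm c}(G)\in\mathcal G$ for every $G\in\mathcal G$. -}

module Defs where

open import Data.Nat using (ℕ; zero; suc; _+_; _*_; _≤_; _≡ᵇ_)
open import Data.Bool using (Bool; true; false; if_then_else_; _∨_; _∧_; not)
open import Data.Fin using (Fin; toℕ)
open import Data.Fin.Properties using (_≟_)
open import Data.Fin.Subset using (Subset; _∈_; _∉_; _⊆_; ∣_∣)
open import Data.List using (List; map; allFin)
open import Data.Nat.ListAction using (sum)
open import Data.Product using (Σ; ∃; _×_; _,_)
open import Data.Sum using (_⊎_)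
open import Relation.Nullary using (¬_; does)
open import Relation.Binary.PropositionalEquality using (_≡_; _≢_)

Graph : ℕ → Set
Graph n = Fin n → Fin n → Bool

IsSimple : ∀ {n} → Graph n → Set
IsSimple {n} G = (∀ u v → G u v ≡ G v u) × (∀ u → G u u ≡ false)

Adj : ∀ {n} → Graph n → Fin n → Fin n → Set
Adj G u v = G u v ≡ true

deg : ∀ {n} → Graph n → Fin n → ℕ
deg {n} G v = sum (map (λ u → if G v u then 1 else 0) (allFin n))

-- v heavy iff d(v) ≥ n/2, i.e. 2·d(v) ≥ n
Heavy : ∀ {n} → Graph n → Fin n → Set
Heavy {n} G v = n ≤ 2 * deg G v

HeavyPair : ∀ {n} → Graph n → Fin n → Fin n → Set
HeavyPair {n} G u v = u ≢ v × G u v ≡ false × n ≤ deg G u + deg G v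

IsInducedClaw : ∀ {n} → Graph n → Fin n → Fin n → Fin n → Fin n → Set
IsInducedClaw G c a₁ a₂ a₃ =
  Adj G c a₁ × Adj G c a₂ × Adj G c a₃ ×
  a₁ ≢ a₂ × a₁ ≢ a₃ × a₂ ≢ a₃ ×
  G a₁ a₂ ≡ false × G a₁ a₃ ≡ false × G a₂ a₃ ≡ false

-- every induced claw contains a heavy pair (only leaf pairs are nonadjacent)
ClawOHeavy : ∀ {n} → Graph n → Set
ClawOHeavy G = ∀ c a₁ a₂ a₃ → IsInducedClaw G c a₁ a₂ a₃ →
  HeavyPair G a₁ a₂ ⊎ HeavyPair G a₁ a₃ ⊎ HeavyPair G a₂ a₃

pathGraph : (i : ℕ) → Graph i
pathGraph i a b = (toℕ a ≡ᵇ suc (toℕ b)) ∨ (toℕ b ≡ᵇ suc (toℕ a))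

data Walk {A : Set} (E : A → A → Set) (P : A → Set) : A → A → Set where
  here  : ∀ {a} → P a → Walk E P a a
  step  : ∀ {a b c} → P a → E a b → Walk E P b c → Walk E P a c

IsClique : ∀ {k} → Graph k → Subset k → Set
IsClique S C = ∀ a b → a ∈ C → b ∈ C → a ≢ b → Adj S a b

IsMaximalClique : ∀ {k} → Graph k → Subset k → Set
IsMaximalClique S C = IsClique S C × (∀ D → IsClique S D → C ⊆ D → D ⊆ C)

-- K is the vertex set of a connected component of S - C
IsComponentMinus : ∀ {k} → Graph k → Subset k → Subset k → Set
IsComponentMinus S C K =
  (∃ λ a → a ∈ K) ×
  (∀ a → a ∈ K → a ∉ C) ×
  (∀ a b → a ∈ K → b ∈ K → Walk (Adj S) (_∈ K) a b) ×
  (∀ a b → a ∈ K → b ∉ C → Adj S a b → b ∈ K)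

IsInducedEmbedding : ∀ {k n} → Graph k → Graph n → (Fin k → Fin n) → Set
IsInducedEmbedding S G f = (∀ a b → f a ≡ f b → a ≡ b) × (∀ a b → S a b ≡ G (f a) (f b))

ScHeavy : ∀ {k n} → Graph k → Graph n → Set
ScHeavy S G = ∀ f → IsInducedEmbedding S G f →
  ∀ C → IsMaximalClique S C →
  ∀ K → IsComponentMinus S C K → 2 ≤ ∣ K ∣ →
  ∃ λ a → a ∈ K × Heavy G (f a)

localComp : ∀ {n} → Graph n → Fin n → Graph n
localComp G x u v = G u v ∨ (G x u ∧ G x v ∧ not (does (u ≟ v)))

StarAdj : ∀ {n} → Graph n → Fin n → Fin n → Fin n → Set
StarAdj G x u v = Adj G u v ⊎ (Adj G x u × Adj G x v × HeavyPair G u v)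

InN : ∀ {n} → Graph n → Fin n → Fin n → Set
InN G x u = Adj G x u

CEligible : ∀ {n} → Graph n → Fin n → Set
CEligible {n} G x =
  (∃ λ u → ∃ λ v → Adj G x u × Adj G x v × u ≢ v × G u v ≡ false) ×
  ( (∀ u v → Adj G x u → Adj G x v → Walk (StarAdj G x) (InN G x) u v)
  ⊎ (Σ (Subset n) λ C₁ → Σ (Subset n) λ C₂ →
       (∀ u → Adj G x u → u ∈ C₁ ⊎ u ∈ C₂) ×
       (∀ u → u ∈ C₁ ⊎ u ∈ C₂ → Adj G x u) ×
       (∀ u → u ∈ C₁ → u ∉ C₂) ×
       (∃ λ u → u ∈ C₁) × (∃ λ u → u ∈ C₂) ×
       (∀ u v → u ∈ C₁ → v ∈ C₁ → u ≢ v → StarAdj G x u v) ×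
       (∀ u v → u ∈ C₂ → v ∈ C₂ → u ≢ v → StarAdj G x u v) ×
       (∀ u v → u ∈ C₁ → v ∈ C₂ → ¬ StarAdj G x u v) ×
       (∃ λ z → HeavyPair G x z × ∃ λ y₁ → ∃ λ y₂ →
          y₁ ∈ C₁ × y₂ ∈ C₂ × Adj G z y₁ × Adj G z y₂)))

data CClosure {n : ℕ} : Graph n → Graph n → Set where
  done : ∀ {G} → (∀ x → ¬ CEligible G x) → CClosure G G
  step : ∀ {G H} x → CEligible G x → CClosure (localComp G x) H → CClosure G H

-- Neither property needs c-eligibility: both are preserved
-- by the local completion G ↦ G'_x at an arbitrary vertex x of a simple graph,
-- and the theorem follows by induction along the closure sequence.
--
-- Both invariance results rest on two degree facts: local completion never
-- lowers a degree, and it raises the degree of every neighbour a of x to at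
-- least d_G(x) (a gains x and all of N_G(x) - a, and loses nothing).
--  * Claw-o-heavy: an induced claw of G'_x is an induced claw of G, unless one
--    of its spokes c p is new; then c, p ∈ N_G(x), and replacing the leaf p by
--    x gives an induced claw of G whose heavy pairs lift to G'_x.
--  * P_i-c-heavy: an induced P_i of G'_x is induced in G, unless one of its
--    edges u₀u₁ is new; then x is adjacent to u₀, u₁ and to no other path
--    vertex, so inserting x between u₀ and u₁ gives an induced P_{i+1} of G.
--    Its first or last i vertices form an induced P_i of G carrying the same
--    clique/component data, and the heavy vertex of G found there yields a
--    heavy vertex of G'_x inside the original component, since components of
--    a path minus a clique are intervals.
module Submission where

open import Defs
open import Data.Bool using (Bool; true; false; if_then_else_; _∨_; _∧_; not)
open import Data.Bool.Properties using (¬-not; T-≡; ∨-comm; ∨-zeroʳ; ∧-zeroʳ)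
import Data.Bool.Properties as Bool
open import Data.Empty using (⊥; ⊥-elim)
open import Data.Fin using (Fin; zero; suc; toℕ; fromℕ<)
open import Data.Fin.Properties using (_≟_; toℕ-injective; toℕ<n; toℕ-fromℕ<; any?)
open import Data.Fin.Subset using (Subset; _∈_; ∣_∣)
open import Data.List using (tabulate)
open import Data.List.Properties using (map-tabulate)
open import Data.Nat using (ℕ; zero; suc; _+_; _≤_; _<_; _≡ᵇ_; z≤n; s≤s; _≤?_)
open import Data.Nat.ListAction using (sum)
open import Data.Nat.Properties
  using ( +-0-commutativeMonoid; ≤-refl; ≤-trans; ≤-antisym; <⇒≤; ≤-<-trans
        ; n≤1+n; m≤n+m; m≤n⇒m≤1+n; ≤∧≢⇒<; ≤-reflexive; ≰⇒>; ≤-pred; suc-injective; +-mono-≤; +-comm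
        ; +-cancelʳ-≤; *-monoʳ-≤; ≡ᵇ⇒≡; ≡⇒≡ᵇ; m≢1+n+m; <⇒≢; module ≤-Reasoning)
import Data.Nat.Properties as ℕ
open import Data.Product using (∃; _×_; _,_; proj₁; proj₂)
open import Data.Sum using (_⊎_; inj₁; inj₂; [_,_]′)
open import Function using (_∘_; id; Equivalence)
open import Relation.Nullary using (¬_; does; yes; no)
open import Relation.Nullary.Decidable using (_×-dec_)
open import Relation.Binary.PropositionalEquality
  using (_≡_; _≢_; refl; sym; trans; cong; subst; subst₂; ≢-sym)

open import Algebra.Properties.CommutativeMonoid.Sum +-0-commutativeMonoid
  using (∑-distrib-+; sum-replicate-zero) renaming (sum to ∑)

true≢false : true ≢ false
true≢false ()

∧-swap : ∀ a b c → a ∧ b ∧ c ≡ b ∧ a ∧ c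
∧-swap true true c = refl
∧-swap true false c = refl
∧-swap false true c = refl
∧-swap false false c = refl

≟-does-sym : ∀ {n} (u v : Fin n) → does (u ≟ v) ≡ does (v ≟ u)
≟-does-sym u v with u ≟ v | v ≟ u
... | yes _ | yes _ = refl
... | no _ | no _ = refl
... | yes u≡v | no v≢u = ⊥-elim (v≢u (sym u≡v))
... | no u≢v | yes v≡u = ⊥-elim (u≢v (sym v≡u))

indicator : Bool → ℕ
indicator b = if b then 1 else 0

indicator-mono : ∀ {b c} → (b ≡ true → c ≡ true) → indicator b ≤ indicator c
indicator-mono {false} _ = z≤n
indicator-mono {true} b⇒c rewrite b⇒c refl = ≤-refl

deg-∑ : ∀ {n} (G : Graph n) v → deg G v ≡ ∑ (λ u → indicator (G v u))
deg-∑ {n} G v = trans (cong sum (map-tabulate {n = n} id (indicator ∘ G v)))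
                       (sum-tabulate (indicator ∘ G v))
  where
  sum-tabulate : ∀ {m} (h : Fin m → ℕ) → sum (tabulate h) ≡ ∑ h
  sum-tabulate {zero} h = refl
  sum-tabulate {suc m} h = cong (h zero +_) (sum-tabulate (h ∘ suc))

∑-mono-≤ : ∀ {n} {f g : Fin n → ℕ} → (∀ u → f u ≤ g u) → ∑ f ≤ ∑ g
∑-mono-≤ {zero} _ = z≤n
∑-mono-≤ {suc n} f≤g = +-mono-≤ (f≤g zero) (∑-mono-≤ (f≤g ∘ suc))

δ : ∀ {n} → Fin n → Fin n → ℕ
δ a u = indicator (does (u ≟ a))

∑-δ : ∀ {n} (a : Fin n) → ∑ (δ a) ≡ 1
∑-δ {suc n} zero = cong suc (sum-replicate-zero n)
∑-δ {suc n} (suc a) = ∑-δ a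

-- Exchange lemma: if f plus a unit at p is pointwise below g plus a unit at
-- q, then ∑ f ≤ ∑ g.  This is how a neighbour of x is compared with x.
∑-exchange : ∀ {n} {f g : Fin n → ℕ} p q →
  (∀ u → f u + δ p u ≤ g u + δ q u) → ∑ f ≤ ∑ g
∑-exchange {f = f} {g} p q pointwise = +-cancelʳ-≤ 1 (∑ f) (∑ g) (begin
  ∑ f + 1                ≡⟨ cong (∑ f +_) (∑-δ p) ⟨
  ∑ f + ∑ (δ p)          ≡⟨ ∑-distrib-+ f (δ p) ⟨
  ∑ (λ u → f u + δ p u)  ≤⟨ ∑-mono-≤ pointwise ⟩
  ∑ (λ u → g u + δ q u)  ≡⟨ ∑-distrib-+ g (δ q) ⟩
  ∑ g + ∑ (δ q)          ≡⟨ cong (∑ g +_) (∑-δ q) ⟩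
  ∑ g + 1                ∎)
  where open ≤-Reasoning

heavyPair-sym : ∀ {n} {H : Graph n} → (∀ u v → H u v ≡ H v u) →
  ∀ {u v} → HeavyPair H u v → HeavyPair H v u
heavyPair-sym {n} {H} symmetric {u} {v} (u≢v , uv∉H , heavy) =
  ≢-sym u≢v , trans (symmetric v u) uv∉H , subst (n ≤_) (+-comm (deg H u) (deg H v)) heavy

HeavyLeafPair : ∀ {n} → Graph n → Fin n → Fin n → Fin n → Set
HeavyLeafPair H p q r = HeavyPair H p q ⊎ HeavyPair H p r ⊎ HeavyPair H q r

module LeafOrder {n} {H : Graph n} (symmetric : ∀ u v → H u v ≡ H v u) {p q r : Fin n} where

  swap-first-two : HeavyLeafPair H q p r → HeavyLeafPair H p q r
  swap-first-two (inj₁ qp) = inj₁ (heavyPair-sym symmetric qp)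
  swap-first-two (inj₂ (inj₁ qr)) = inj₂ (inj₂ qr)
  swap-first-two (inj₂ (inj₂ pr)) = inj₂ (inj₁ pr)

  rotate : HeavyLeafPair H r p q → HeavyLeafPair H p q r
  rotate (inj₁ rp) = inj₂ (inj₁ (heavyPair-sym symmetric rp))
  rotate (inj₂ (inj₁ rq)) = inj₂ (inj₂ (heavyPair-sym symmetric rq))
  rotate (inj₂ (inj₂ pq)) = inj₁ pq

module LocalCompletion {n : ℕ} (G : Graph n) (simple : IsSimple G) (x : Fin n) where

  G' : Graph n
  G' = localComp G x

  symmetric : ∀ u v → G u v ≡ G v u
  symmetric = proj₁ simple

  loopless : ∀ u → G u u ≡ false
  loopless = proj₂ simple

  edge-kept : ∀ {u v} → Adj G u v → Adj G' u v
  edge-kept uv rewrite uv = refl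

  non-edge-reflected : ∀ {u v} → G' u v ≡ false → G u v ≡ false
  non-edge-reflected uv∉G' = ¬-not (λ uv → true≢false (trans (sym (edge-kept uv)) uv∉G'))

  neighbours-joined : ∀ {u v} → Adj G x u → Adj G x v → u ≢ v → Adj G' u v
  neighbours-joined {u} {v} xu xv u≢v with G u v
  ... | true = refl
  ... | false rewrite xu | xv with u ≟ v
  ...   | yes u≡v = ⊥-elim (u≢v u≡v)
  ...   | no _ = refl

  new-edge : ∀ {u v} → Adj G' u v → G u v ≡ false → Adj G x u × Adj G x v × u ≢ v
  new-edge {u} {v} uv∈G' uv∉G rewrite uv∉G with G x u | G x v | u ≟ v
  ... | true | true | no u≢v = refl , refl , u≢v
  ... | true | true | yes _ = ⊥-elim (true≢false (sym uv∈G'))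
  ... | true | false | _ = ⊥-elim (true≢false (sym uv∈G'))
  ... | false | _ | _ = ⊥-elim (true≢false (sym uv∈G'))

  agree-off-new-edges : ∀ u v → ¬ (G u v ≡ false × Adj G' u v) → G' u v ≡ G u v
  agree-off-new-edges u v not-new with G u v
  ... | true = refl
  ... | false = ¬-not (λ uv∈G' → not-new (refl , uv∈G'))

  symmetric' : ∀ u v → G' u v ≡ G' v u
  symmetric' u v rewrite symmetric u v | ≟-does-sym u v =
    cong (G v u ∨_) (∧-swap (G x u) (G x v) (not (does (v ≟ u))))

  loopless' : ∀ u → G' u u ≡ false
  loopless' u rewrite loopless u with u ≟ u
  ... | yes _ = trans (cong (G x u ∧_) (∧-zeroʳ (G x u))) (∧-zeroʳ (G x u))
  ... | no u≢u = ⊥-elim (u≢u refl)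

  localComp-simple : IsSimple G'
  localComp-simple = symmetric' , loopless'

  deg-mono : ∀ v → deg G v ≤ deg G' v
  deg-mono v = subst₂ _≤_ (sym (deg-∑ G v)) (sym (deg-∑ G' v))
    (∑-mono-≤ (λ u → indicator-mono (edge-kept {v} {u})))

  -- A neighbour a of x gains x and N_G(x) - a, so d_G'(a) ≥ d_G(x).
  deg-neighbour : ∀ {a} → Adj G x a → deg G x ≤ deg G' a
  deg-neighbour {a} xa = subst₂ _≤_ (sym (deg-∑ G x)) (sym (deg-∑ G' a))
    (∑-exchange x a pointwise)
    where
    a≢x : a ≢ x
    a≢x refl = true≢false (trans (sym xa) (loopless a))
    pointwise : ∀ u → indicator (G x u) + δ x u ≤ indicator (G' a u) + δ a u
    pointwise u with u ≟ a | u ≟ x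
    ... | yes refl | yes a≡x = ⊥-elim (a≢x a≡x)
    ... | yes refl | no _ rewrite xa = m≤n+m 1 _
    ... | no _ | yes refl rewrite loopless x | trans (symmetric a x) xa = ≤-refl
    ... | no u≢a | no _ =
      +-mono-≤ (indicator-mono (λ xu → neighbours-joined xa xu (≢-sym u≢a))) ≤-refl

  heavy-mono : ∀ {v} → Heavy G v → Heavy G' v
  heavy-mono {v} heavy = ≤-trans heavy (*-monoʳ-≤ 2 (deg-mono v))

  heavy-neighbour : ∀ {a} → Adj G x a → Heavy G x → Heavy G' a
  heavy-neighbour xa heavy = ≤-trans heavy (*-monoʳ-≤ 2 (deg-neighbour xa))

  heavyPair-mono : ∀ {u v} → HeavyPair G u v → G' u v ≡ false → HeavyPair G' u v
  heavyPair-mono {u} {v} (u≢v , _ , heavy) uv∉G' =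
    u≢v , uv∉G' , ≤-trans heavy (+-mono-≤ (deg-mono u) (deg-mono v))

  heavyPair-via-x : ∀ {p w} → Adj G x p → p ≢ w → G' p w ≡ false →
    HeavyPair G x w → HeavyPair G' p w
  heavyPair-via-x {p} {w} xp p≢w pw∉G' (_ , _ , heavy) =
    p≢w , pw∉G' , ≤-trans heavy (+-mono-≤ (deg-neighbour xp) (deg-mono w))

module ClawInvariance {n} (G : Graph n) (simple : IsSimple G) (x : Fin n)
  (clawOHeavy : ClawOHeavy G) where

  open LocalCompletion G simple x
  open LeafOrder symmetric'

  -- A claw of G' whose spoke c p is new: then c, p ∈ N_G(x), and c with
  -- leaves x, q, r is an induced claw of G.
  claw-with-new-spoke : ∀ c p q r → G c p ≡ false → IsInducedClaw G' c p q r →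
    HeavyLeafPair G' p q r
  claw-with-new-spoke c p q r cp∉G (cp , cq , cr , p≢q , p≢r , q≢r , pq∉G' , pr∉G' , qr∉G') =
    lift (clawOHeavy c x q r claw)
    where
    xc : Adj G x c
    xc = proj₁ (new-edge cp cp∉G)
    xp : Adj G x p
    xp = proj₁ (proj₂ (new-edge cp cp∉G))
    -- leaves other than p lie outside N_G(x), since N_G(x) is a clique in G'
    outside : ∀ {w} → p ≢ w → G' p w ≡ false → G x w ≡ false
    outside p≢w pw∉G' =
      ¬-not (λ xw → true≢false (trans (sym (neighbours-joined xp xw p≢w)) pw∉G'))
    not-x : ∀ {w} → G' p w ≡ false → x ≢ w
    not-x pw∉G' refl = true≢false (trans (sym (edge-kept (trans (symmetric p x) xp))) pw∉G')
    xq : G x q ≡ false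
    xq = outside p≢q pq∉G'
    xr : G x r ≡ false
    xr = outside p≢r pr∉G'
    old-spoke : ∀ {w} → G x w ≡ false → Adj G' c w → Adj G c w
    old-spoke xw cw =
      ¬-not (λ cw∉G → true≢false (trans (sym (proj₁ (proj₂ (new-edge cw cw∉G)))) xw))
    claw : IsInducedClaw G c x q r
    claw = trans (symmetric c x) xc , old-spoke xq cq , old-spoke xr cr
         , not-x pq∉G' , not-x pr∉G' , q≢r , xq , xr , non-edge-reflected qr∉G'
    lift : HeavyLeafPair G x q r → HeavyLeafPair G' p q r
    lift (inj₁ xq-heavy) = inj₁ (heavyPair-via-x xp p≢q pq∉G' xq-heavy)
    lift (inj₂ (inj₁ xr-heavy)) = inj₂ (inj₁ (heavyPair-via-x xp p≢r pr∉G' xr-heavy))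
    lift (inj₂ (inj₂ qr)) = inj₂ (inj₂ (heavyPair-mono qr qr∉G'))

  localComp-clawOHeavy : ClawOHeavy G'
  localComp-clawOHeavy c a₁ a₂ a₃ claw@(c₁ , c₂ , c₃ , d₁₂ , d₁₃ , d₂₃ , n₁₂ , n₁₃ , n₂₃)
    with G c a₁ Bool.≟ true | G c a₂ Bool.≟ true | G c a₃ Bool.≟ true
  ... | no ¬c₁ | _ | _ = claw-with-new-spoke c a₁ a₂ a₃ (¬-not ¬c₁) claw
  ... | yes _ | no ¬c₂ | _ = swap-first-two (claw-with-new-spoke c a₂ a₁ a₃ (¬-not ¬c₂)
      (c₂ , c₁ , c₃ , ≢-sym d₁₂ , d₂₃ , d₁₃ , trans (symmetric' a₂ a₁) n₁₂ , n₂₃ , n₁₃))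
  ... | yes _ | yes _ | no ¬c₃ = rotate (claw-with-new-spoke c a₃ a₁ a₂ (¬-not ¬c₃)
      (c₃ , c₁ , c₂ , ≢-sym d₁₃ , ≢-sym d₂₃ , d₁₂
      , trans (symmetric' a₃ a₁) n₁₃ , trans (symmetric' a₃ a₂) n₂₃ , n₁₂))
  ... | yes g₁ | yes g₂ | yes g₃ with clawOHeavy c a₁ a₂ a₃ (g₁ , g₂ , g₃ , d₁₂ , d₁₃ , d₂₃
      , non-edge-reflected n₁₂ , non-edge-reflected n₁₃ , non-edge-reflected n₂₃)
  ...   | inj₁ h₁₂ = inj₁ (heavyPair-mono h₁₂ n₁₂)
  ...   | inj₂ (inj₁ h₁₃) = inj₂ (inj₁ (heavyPair-mono h₁₃ n₁₃))
  ...   | inj₂ (inj₂ h₂₃) = inj₂ (inj₂ (heavyPair-mono h₂₃ n₂₃))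

-- Adjacency of the infinite path 0 - 1 - 2 - …; pathGraph i is its
-- restriction to {0, …, i-1}.
pathAdj : ℕ → ℕ → Bool
pathAdj m k = (m ≡ᵇ suc k) ∨ (k ≡ᵇ suc m)

≡ᵇ-true : ∀ {m k} → (m ≡ᵇ k) ≡ true → m ≡ k
≡ᵇ-true {m} {k} m≡ᵇk = ≡ᵇ⇒≡ m k (Equivalence.from T-≡ m≡ᵇk)

≡ᵇ-false : ∀ {m k} → m ≢ k → (m ≡ᵇ k) ≡ false
≡ᵇ-false m≢k = ¬-not (m≢k ∘ ≡ᵇ-true)

≡ᵇ-refl : ∀ m → (m ≡ᵇ m) ≡ true
≡ᵇ-refl m = Equivalence.to T-≡ (≡⇒≡ᵇ m m refl)

path-adjacent : ∀ m k → pathAdj m k ≡ true → m ≡ suc k ⊎ k ≡ suc m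
path-adjacent m k adj with m ≡ᵇ suc k in m≡ᵇsk
... | true = inj₁ (≡ᵇ-true m≡ᵇsk)
... | false = inj₂ (≡ᵇ-true adj)

path-nonadjacent : ∀ {m k} → m ≢ suc k → k ≢ suc m → pathAdj m k ≡ false
path-nonadjacent m≢sk k≢sm rewrite ≡ᵇ-false m≢sk | ≡ᵇ-false k≢sm = refl

pathAdj-sym : ∀ m k → pathAdj m k ≡ pathAdj k m
pathAdj-sym m k = ∨-comm (m ≡ᵇ suc k) (k ≡ᵇ suc m)

pathAdj-succ : ∀ m → pathAdj m (suc m) ≡ true
pathAdj-succ m rewrite ≡ᵇ-refl m = ∨-zeroʳ _

no-common-neighbour : ∀ t m → pathAdj t m ≡ true → pathAdj t (suc m) ≡ true → ⊥
no-common-neighbour t m t∼m t∼sm with path-adjacent t m t∼m | path-adjacent t (suc m) t∼sm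
... | inj₁ refl | inj₁ e = m≢1+n+m (suc m) {0} e
... | inj₁ refl | inj₂ e = m≢1+n+m (suc m) {0} e
... | inj₂ refl | inj₁ e = m≢1+n+m t {2} e
... | inj₂ refl | inj₂ e = m≢1+n+m (suc t) {0} (sym e)

Between : ℕ → ℕ → ℕ → Set
Between a b c = (a ≤ b × b ≤ c) ⊎ (c ≤ b × b ≤ a)

between-point : ∀ {a b} → Between a b a → b ≡ a
between-point (inj₁ (a≤b , b≤a)) = ≤-antisym b≤a a≤b
between-point (inj₂ (a≤b , b≤a)) = ≤-antisym b≤a a≤b

between-step : ∀ {a a' b c} → b ≢ a → a ≡ suc a' ⊎ a' ≡ suc a →
  Between a b c → Between a' b c
between-step b≢a (inj₁ refl) (inj₁ (a≤b , b≤c)) = inj₁ (≤-trans (n≤1+n _) a≤b , b≤c)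
between-step b≢a (inj₂ refl) (inj₁ (a≤b , b≤c)) = inj₁ (≤∧≢⇒< a≤b (≢-sym b≢a) , b≤c)
between-step b≢a (inj₁ refl) (inj₂ (c≤b , b≤a)) = inj₂ (c≤b , ≤-pred (≤∧≢⇒< b≤a b≢a))
between-step b≢a (inj₂ refl) (inj₂ (c≤b , b≤a)) = inj₂ (c≤b , m≤n⇒m≤1+n b≤a)

-- A walk of P_i inside K passes through every vertex between its ends;
-- hence components of P_i minus a clique are intervals.
walk-interval : ∀ {i} {K : Subset i} {s t} → Walk (Adj (pathGraph i)) (_∈ K) s t →
  ∀ u → Between (toℕ s) (toℕ u) (toℕ t) → u ∈ K
walk-interval {K = K} (here s∈K) u s≤u≤s =
  subst (_∈ K) (sym (toℕ-injective (between-point s≤u≤s))) s∈K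
walk-interval {K = K} {s} (step s∈K s∼s' rest) u between with toℕ u ℕ.≟ toℕ s
... | yes u≡s = subst (_∈ K) (sym (toℕ-injective u≡s)) s∈K
... | no u≢s = walk-interval rest u (between-step u≢s (path-adjacent (toℕ s) _ s∼s') between)

module Subdivision {n : ℕ} (G : Graph n) (simple : IsSimple G) (x : Fin n) {i : ℕ}
  (f : Fin i → Fin n) (induced : IsInducedEmbedding (pathGraph i) (localComp G x) f)
  (u₀ u₁ : Fin i) (consecutive : toℕ u₁ ≡ suc (toℕ u₀))
  (u₀u₁∉G : G (f u₀) (f u₁) ≡ false) where

  open LocalCompletion G simple x

  j : ℕ
  j = toℕ u₀

  f-injective : ∀ a b → f a ≡ f b → a ≡ b
  f-injective = proj₁ induced

  f-adjacency : ∀ a b → G' (f a) (f b) ≡ pathAdj (toℕ a) (toℕ b)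
  f-adjacency a b = sym (proj₂ induced a b)

  j∼u₁ : pathAdj j (toℕ u₁) ≡ true
  j∼u₁ = subst (λ k → pathAdj j k ≡ true) (sym consecutive) (pathAdj-succ j)

  u₀u₁∈G' : Adj G' (f u₀) (f u₁)
  u₀u₁∈G' = trans (f-adjacency u₀ u₁) j∼u₁

  x∼u₀ : Adj G x (f u₀)
  x∼u₀ = proj₁ (new-edge u₀u₁∈G' u₀u₁∉G)

  x∼u₁ : Adj G x (f u₁)
  x∼u₁ = proj₁ (proj₂ (new-edge u₀u₁∈G' u₀u₁∉G))

  -- The path is triangle-free, so no vertex is G'-adjacent to both u₀ and u₁.
  not-both : ∀ w → Adj G' (f w) (f u₀) → Adj G' (f w) (f u₁) → ⊥
  not-both w w∼u₀ w∼u₁ = no-common-neighbour (toℕ w) j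
    (trans (sym (f-adjacency w u₀)) w∼u₀)
    (subst (λ k → pathAdj (toℕ w) k ≡ true) consecutive (trans (sym (f-adjacency w u₁)) w∼u₁))

  -- x sees only u₀ and u₁ on the path: any further neighbour would be joined
  -- to both of them in G'.
  x-neighbours : ∀ w → Adj G x (f w) → toℕ w ≡ j ⊎ toℕ w ≡ suc j
  x-neighbours w xw with toℕ w ℕ.≟ j | toℕ w ℕ.≟ suc j
  ... | yes w≡j | _ = inj₁ w≡j
  ... | no _ | yes w≡sj = inj₂ w≡sj
  ... | no w≢j | no w≢sj = ⊥-elim (not-both w
    (neighbours-joined xw x∼u₀ (w≢j ∘ cong toℕ ∘ f-injective w u₀))
    (neighbours-joined xw x∼u₁ (λ e → w≢sj (trans (cong toℕ (f-injective w u₁ e)) consecutive))))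

  x-nonadjacent : ∀ w → toℕ w ≢ j → toℕ w ≢ suc j → G x (f w) ≡ false
  x-nonadjacent w w≢j w≢sj = ¬-not (λ xw → [ w≢j , w≢sj ]′ (x-neighbours w xw))

  -- x itself is not on the path, for the same reason.
  x-off-path : ∀ w → x ≢ f w
  x-off-path w x≡fw = not-both w
    (edge-kept (subst (λ v → Adj G v (f u₀)) x≡fw x∼u₀))
    (edge-kept (subst (λ v → Adj G v (f u₁)) x≡fw x∼u₁))

  -- Apart from the pair {u₀, u₁}, G itself induces the path on the image of f:
  -- a new edge joins two neighbours of x, i.e. it is u₀u₁.
  G-on-path : ∀ u w → ¬ (toℕ u ≡ j × toℕ w ≡ suc j) → ¬ (toℕ u ≡ suc j × toℕ w ≡ j) →
    G (f u) (f w) ≡ pathAdj (toℕ u) (toℕ w)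
  G-on-path u w not₀₁ not₁₀ =
    trans (sym (agree-off-new-edges (f u) (f w) not-new)) (f-adjacency u w)
    where
    not-new : ¬ (G (f u) (f w) ≡ false × Adj G' (f u) (f w))
    not-new (uw∉G , uw∈G') with new-edge uw∈G' uw∉G
    ... | xu , xw , fu≢fw with x-neighbours u xu | x-neighbours w xw
    ...   | inj₁ u≡j | inj₁ w≡j = fu≢fw (cong f (toℕ-injective (trans u≡j (sym w≡j))))
    ...   | inj₁ u≡j | inj₂ w≡sj = not₀₁ (u≡j , w≡sj)
    ...   | inj₂ u≡sj | inj₁ w≡j = not₁₀ (u≡sj , w≡j)
    ...   | inj₂ u≡sj | inj₂ w≡sj = fu≢fw (cong f (toℕ-injective (trans u≡sj (sym w≡sj))))

  no-crossing : ∀ u w → toℕ u ≤ j → suc j ≤ toℕ w → G (f u) (f w) ≡ false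
  no-crossing u w u≤j sj≤w with (toℕ u ℕ.≟ j) ×-dec (toℕ w ℕ.≟ suc j)
  ... | yes (u≡j , w≡sj) =
    subst₂ (λ a b → G (f a) (f b) ≡ false)
      (sym (toℕ-injective u≡j)) (sym (toℕ-injective (trans w≡sj (sym consecutive)))) u₀u₁∉G
  ... | no not₀₁ = trans (G-on-path u w not₀₁ (λ (u≡sj , _) → <⇒≢ (s≤s u≤j) u≡sj))
    (path-nonadjacent (<⇒≢ (s≤s (≤-trans u≤j (≤-trans (n≤1+n j) sj≤w)))) w≢su)
    where
    w≢su : toℕ w ≢ suc (toℕ u)
    w≢su w≡su = not₀₁ (u≡j , trans w≡su (cong suc u≡j))
      where
      u≡j : toℕ u ≡ j
      u≡j = ≤-antisym u≤j (≤-pred (subst (suc j ≤_) w≡su sj≤w))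

  -- Positions 0 … i of the path obtained by inserting x between u₀ and u₁:
  -- the part up to u₀, then x, then the part from u₁ on (shifted by one).
  data Position (m : ℕ) : Set where
    before   : (u : Fin i) → toℕ u ≡ m → m ≤ j → Position m
    inserted : m ≡ suc j → Position m
    after    : (u : Fin i) → suc (toℕ u) ≡ m → suc j ≤ toℕ u → Position m

  vertex : ∀ {m} → Position m → Fin n
  vertex (before u _ _) = f u
  vertex (inserted _) = x
  vertex (after u _ _) = f u

  position : ∀ m → m ≤ i → Position m
  position m m≤i with m ≤? j
  ... | yes m≤j = before (fromℕ< (≤-<-trans m≤j (toℕ<n u₀))) (toℕ-fromℕ< _) m≤j
  ... | no m≰j with m ℕ.≟ suc j
  ...   | yes m≡sj = inserted m≡sj
  ...   | no m≢sj = after-position m m≤i (≤∧≢⇒< (≰⇒> m≰j) (≢-sym m≢sj))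
    where
    after-position : ∀ m → m ≤ i → suc j < m → Position m
    after-position (suc m') m'<i (s≤s sj≤m') =
      after (fromℕ< m'<i) (cong suc (toℕ-fromℕ< m'<i)) (subst (suc j ≤_) (sym (toℕ-fromℕ< m'<i)) sj≤m')

  -- Both pathAdj and G are symmetric, so each mixed case is proved in one order.
  mirrored : ∀ a b {v w} → pathAdj b a ≡ G w v → pathAdj a b ≡ G v w
  mirrored a b {v} {w} adj = trans (pathAdj-sym a b) (trans adj (symmetric w v))

  before-after : ∀ u w → toℕ u ≤ j → suc j ≤ toℕ w →
    pathAdj (toℕ u) (suc (toℕ w)) ≡ G (f u) (f w)
  before-after u w u≤j sj≤w = trans
    (path-nonadjacent (<⇒≢ (≤-trans u<w (≤-trans (n≤1+n _) (n≤1+n _))))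
                      (λ sw≡su → <⇒≢ u<w (sym (suc-injective sw≡su))))
    (sym (no-crossing u w u≤j sj≤w))
    where
    u<w : toℕ u < toℕ w
    u<w = ≤-trans (s≤s u≤j) sj≤w

  inserted-before : ∀ w → toℕ w ≤ j → pathAdj (suc j) (toℕ w) ≡ G x (f w)
  inserted-before w w≤j with toℕ w ℕ.≟ j
  ... | yes w≡j rewrite toℕ-injective {i} {w} {u₀} w≡j =
    trans (pathAdj-sym (suc j) j) (trans (pathAdj-succ j) (sym x∼u₀))
  ... | no w≢j = trans
    (path-nonadjacent (λ sj≡sw → w≢j (sym (suc-injective sj≡sw))) (<⇒≢ (s≤s (m≤n⇒m≤1+n w≤j))))
    (sym (x-nonadjacent w w≢j (<⇒≢ (s≤s w≤j))))

  inserted-after : ∀ w → suc j ≤ toℕ w → pathAdj (suc j) (suc (toℕ w)) ≡ G x (f w)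
  inserted-after w sj≤w with toℕ w ℕ.≟ suc j
  ... | yes w≡sj rewrite toℕ-injective {i} {w} {u₁} (trans w≡sj (sym consecutive)) =
    trans j∼u₁ (sym x∼u₁)
  ... | no w≢sj = trans
    (path-nonadjacent (<⇒≢ (s≤s (≤-trans (n≤1+n j) sj≤w))) w≢sj)
    (sym (x-nonadjacent w (≢-sym (<⇒≢ sj≤w)) w≢sj))

  position-adjacency : ∀ {a b} (p : Position a) (q : Position b) →
    pathAdj a b ≡ G (vertex p) (vertex q)
  position-adjacency (before u refl u≤j) (before w refl w≤j) = sym (G-on-path u w
    (λ (_ , w≡sj) → <⇒≢ (s≤s w≤j) w≡sj) (λ (u≡sj , _) → <⇒≢ (s≤s u≤j) u≡sj))
  position-adjacency (after u refl sj≤u) (after w refl sj≤w) = sym (G-on-path u w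
    (λ (u≡j , _) → <⇒≢ sj≤u (sym u≡j)) (λ (_ , w≡j) → <⇒≢ sj≤w (sym w≡j)))
  position-adjacency (before u refl u≤j) (after w refl sj≤w) = before-after u w u≤j sj≤w
  position-adjacency (after u refl sj≤u) (before w refl w≤j) =
    mirrored (suc (toℕ u)) (toℕ w) (before-after w u w≤j sj≤u)
  position-adjacency (inserted refl) (before w refl w≤j) = inserted-before w w≤j
  position-adjacency (before u refl u≤j) (inserted refl) = mirrored (toℕ u) (suc j) (inserted-before u u≤j)
  position-adjacency (inserted refl) (after w refl sj≤w) = inserted-after w sj≤w
  position-adjacency (after u refl sj≤u) (inserted refl) = mirrored (suc (toℕ u)) (suc j) (inserted-after u sj≤u)
  position-adjacency (inserted refl) (inserted refl) =
    trans (path-nonadjacent (m≢1+n+m j {0}) (m≢1+n+m j {0})) (sym (loopless x))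

  position-injective : ∀ {a b} (p : Position a) (q : Position b) →
    vertex p ≡ vertex q → a ≡ b
  position-injective (before u refl _) (before w refl _) fu≡fw = cong toℕ (f-injective u w fu≡fw)
  position-injective (after u refl _) (after w refl _) fu≡fw =
    cong (suc ∘ toℕ) (f-injective u w fu≡fw)
  position-injective (before u refl u≤j) (after w refl sj≤w) fu≡fw =
    ⊥-elim (<⇒≢ (≤-trans (s≤s u≤j) sj≤w) (cong toℕ (f-injective u w fu≡fw)))
  position-injective (after u refl sj≤u) (before w refl w≤j) fu≡fw =
    ⊥-elim (<⇒≢ (≤-trans (s≤s w≤j) sj≤u) (cong toℕ (f-injective w u (sym fu≡fw))))
  position-injective (inserted refl) (inserted refl) _ = refl
  position-injective (inserted _) (before w _ _) x≡fw = ⊥-elim (x-off-path w x≡fw)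
  position-injective (inserted _) (after w _ _) x≡fw = ⊥-elim (x-off-path w x≡fw)
  position-injective (before u _ _) (inserted _) fu≡x = ⊥-elim (x-off-path u (sym fu≡x))
  position-injective (after u _ _) (inserted _) fu≡x = ⊥-elim (x-off-path u (sym fu≡x))

  first-window : Fin i → Fin n
  first-window t = vertex (position (toℕ t) (<⇒≤ (toℕ<n t)))

  last-window : Fin i → Fin n
  last-window t = vertex (position (suc (toℕ t)) (toℕ<n t))

  first-window-induced : IsInducedEmbedding (pathGraph i) G first-window
  first-window-induced =
    (λ a b eq → toℕ-injective (position-injective (first a) (first b) eq))
    , (λ a b → position-adjacency (first a) (first b))
    where
    first : (t : Fin i) → Position (toℕ t)
    first t = position (toℕ t) (<⇒≤ (toℕ<n t))

  last-window-induced : IsInducedEmbedding (pathGraph i) G last-window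
  last-window-induced =
    (λ a b eq → toℕ-injective (suc-injective (position-injective (last a) (last b) eq)))
    , (λ a b → position-adjacency (last a) (last b))
    where
    last : (t : Fin i) → Position (suc (toℕ t))
    last t = position (suc (toℕ t)) (toℕ<n t)

  -- A G-heavy vertex of a window at a ∈ K yields a G'-heavy vertex of K: the
  -- path vertex at that position, or u₀ resp. u₁ if the position holds x.
  -- The latter lie between a and some k₀ ∈ K, so walk-interval applies.
  from-first-window : ∀ {K : Subset i} (k₀ a : Fin i) → toℕ k₀ ≤ j →
    Walk (Adj (pathGraph i)) (_∈ K) k₀ a → a ∈ K →
    Heavy G (vertex (position (toℕ a) (<⇒≤ (toℕ<n a)))) → ∃ λ u → u ∈ K × Heavy G' (f u)
  from-first-window {K} k₀ a k₀≤j walk a∈K heavy with position (toℕ a) (<⇒≤ (toℕ<n a))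
  ... | before u u≡a _ = u , subst (_∈ K) (sym (toℕ-injective u≡a)) a∈K , heavy-mono heavy
  ... | inserted a≡sj =
    u₀ , walk-interval walk u₀ (inj₁ (k₀≤j , subst (j ≤_) (sym a≡sj) (n≤1+n j)))
       , heavy-neighbour x∼u₀ heavy
  ... | after u su≡a sj≤u =
    u , walk-interval walk u (inj₁ ( ≤-trans k₀≤j (≤-trans (n≤1+n j) sj≤u)
                                   , subst (toℕ u ≤_) su≡a (n≤1+n _)))
      , heavy-mono heavy

  from-last-window : ∀ {K : Subset i} (k₀ a : Fin i) → j < toℕ k₀ →
    Walk (Adj (pathGraph i)) (_∈ K) a k₀ → a ∈ K →
    Heavy G (vertex (position (suc (toℕ a)) (toℕ<n a))) → ∃ λ u → u ∈ K × Heavy G' (f u)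
  from-last-window {K} k₀ a j<k₀ walk a∈K heavy with position (suc (toℕ a)) (toℕ<n a)
  ... | before u u≡sa sa≤j =
    u , walk-interval walk u (inj₁ ( subst (toℕ a ≤_) (sym u≡sa) (n≤1+n _)
                                   , subst (_≤ toℕ k₀) (sym u≡sa) (≤-trans sa≤j (<⇒≤ j<k₀))))
      , heavy-mono heavy
  ... | inserted sa≡sj =
    u₁ , walk-interval walk u₁ (inj₁ ( subst (toℕ a ≤_) (sym consecutive)
                                         (≤-trans (≤-reflexive (suc-injective sa≡sj)) (n≤1+n j))
                                     , subst (_≤ toℕ k₀) (sym consecutive) j<k₀))
       , heavy-neighbour x∼u₁ heavy
  ... | after u su≡sa _ =
    u , subst (_∈ K) (sym (toℕ-injective (suc-injective su≡sa))) a∈K , heavy-mono heavy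

  -- Conclusion of P_i-c-heaviness of G' for f: apply that of G to the window
  -- on the side of u₀u₁ where K has an element k₀.
  heavy-in-component : ScHeavy (pathGraph i) G → ∀ C → IsMaximalClique (pathGraph i) C →
    ∀ K → IsComponentMinus (pathGraph i) C K → 2 ≤ ∣ K ∣ → ∃ λ u → u ∈ K × Heavy G' (f u)
  heavy-in-component scHeavy C maximal K component@((k₀ , k₀∈K) , _ , walks , _) size
    with toℕ k₀ ≤? j
  ... | yes k₀≤j with scHeavy first-window first-window-induced C maximal K component size
  ...   | a , a∈K , heavy = from-first-window k₀ a k₀≤j (walks k₀ a k₀∈K a∈K) a∈K heavy
  heavy-in-component scHeavy C maximal K component@((k₀ , k₀∈K) , _ , walks , _) size
    | no k₀≰j with scHeavy last-window last-window-induced C maximal K component size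
  ...   | a , a∈K , heavy = from-last-window k₀ a (≰⇒> k₀≰j) (walks a k₀ a∈K k₀∈K) a∈K heavy

module PathInvariance {n : ℕ} (G : Graph n) (simple : IsSimple G) (x : Fin n) (i : ℕ) where

  open LocalCompletion G simple x

  NewEdgeOn : (Fin i → Fin n) → Set
  NewEdgeOn f = ∃ λ a → ∃ λ b → G (f a) (f b) ≡ false × Adj G' (f a) (f b)

  induced-in-G : ∀ {f} → IsInducedEmbedding (pathGraph i) G' f → ¬ NewEdgeOn f →
    IsInducedEmbedding (pathGraph i) G f
  induced-in-G {f} induced no-new-edge = proj₁ induced , λ a b →
    trans (proj₂ induced a b) (agree-off-new-edges (f a) (f b) (λ new → no-new-edge (a , b , new)))

  -- A new edge on an induced path joins consecutive vertices; Subdivision applies.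
  localComp-ScHeavy-path : ScHeavy (pathGraph i) G → ScHeavy (pathGraph i) G'
  localComp-ScHeavy-path scHeavy f induced C maximal K component size
    with any? (λ a → any? (λ b → (G (f a) (f b) Bool.≟ false) ×-dec (G' (f a) (f b) Bool.≟ true)))
  ... | no no-new-edge with scHeavy f (induced-in-G induced no-new-edge) C maximal K component size
  ...   | a , a∈K , heavy = a , a∈K , heavy-mono heavy
  localComp-ScHeavy-path scHeavy f induced C maximal K component size
    | yes (a , b , ab∉G , ab∈G') with path-adjacent (toℕ a) (toℕ b) (trans (proj₂ induced a b) ab∈G')
  ... | inj₁ a≡sb = Subdivision.heavy-in-component G simple x f induced b a a≡sb
          (trans (symmetric (f b) (f a)) ab∉G) scHeavy C maximal K component size
  ... | inj₂ b≡sa = Subdivision.heavy-in-component G simple x f induced a b b≡sa ab∉G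
          scHeavy C maximal K component size

closure-invariant : ∀ {n} (P : Graph n → Set) →
  (∀ G x → IsSimple G → P G → P (localComp G x)) →
  ∀ {G H} → IsSimple G → P G → CClosure G H → P H
closure-invariant P preserved simple holds (done _) = holds
closure-invariant P preserved {G} simple holds (step x _ rest) =
  closure-invariant P preserved (LocalCompletion.localComp-simple G simple x)
    (preserved G x simple holds) rest

-- The theorem: both properties are invariant under local completion, hence
-- under the c-closure.
corollary6 : (i : ℕ) → 3 ≤ i → (n : ℕ) → (G H : Graph n) →
    IsSimple G → ClawOHeavy G → ScHeavy (pathGraph i) G →
    CClosure G H →
    ClawOHeavy H × ScHeavy (pathGraph i) H
corollary6 i _ n G H simple clawOHeavy scHeavy closure =
  closure-invariant (λ F → ClawOHeavy F × ScHeavy (pathGraph i) F) both-preserved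
    simple (clawOHeavy , scHeavy) closure
  where
  both-preserved : ∀ F x → IsSimple F → ClawOHeavy F × ScHeavy (pathGraph i) F →
    ClawOHeavy (localComp F x) × ScHeavy (pathGraph i) (localComp F x)
  both-preserved F x simpleF (clawF , scF) =
    ClawInvariance.localComp-clawOHeavy F simpleF x clawF
    , PathInvariance.localComp-ScHeavy-path F simpleF x i scF
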